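{- Fix a row parameter $x$ and column parameters $y_1,\dots,y_n$. Consider $1\times n$ rows of tiles which contain a single pipe (and no pipe crosses their South boundary). There is a bijection between such rows of type $\mathsf e$ and such rows of type $\mathsf w$ that preserves the weight $\prod_{j=1}^n \mathrm{wt}(\text{tile}_j,\,x-y_j)$.
   Context: A row of type $\mathsf w$ is a $1\times n$ row of unit squares filled with tiles from: blank (no pipe), horizontal (joining West and East edge midpoints), vertical (joining South and North), cross (horizontal and vertical), single elbow joining West to North, single elbow joining South to East, double elbow (both of these); pipes must match across shared edges, a pipe enters through the West end, no pipe exits through the East end. A row of type $\mathsf e$ is the same with elbows replaced by: single elbow joining East to North, single elbow joining South to West, double elbow (both), and with a pipe entering through the East end and none exiting through the West end. Weights in $\mathbb Z[x,y_1,\dots,y_n,A,B]$: elbow tiles have weight $A+B$; in a type $\mathsf w$ row, a blank tile in column $j$ has weight $B-x+y_j$ and a straight tile (horizontal, vertical, cross) has weight $A+x-y_j$; in a type $\mathsf e$ row, a blank tile has weight $A+x-y_j$ and a straight tile has weight $B-x+y_j$. -}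

module Defs where

open import Level using (0ℓ)
open import Data.Bool using (Bool; true; false)
open import Data.Unit using (⊤)
open import Data.Nat using (ℕ; zero; suc)
open import Data.Vec using (Vec; []; _∷_)
open import Data.Product using (Σ; _×_)
open import Relation.Binary.PropositionalEquality using (_≡_)
open import Algebra.Bundles using (CommutativeRing)

-- Row types: 𝗐 (pipe enters West) and 𝖾 (pipe enters East).
data RowType : Set where
  𝗐 𝖾 : RowType

-- The meaning of the elbow tiles depends on the row type:
--   type 𝗐 : elbowA = West–North, elbowB = South–East
--   type 𝖾 : elbowA = East–North, elbowB = South–West
--   doubleElbow = elbowA and elbowB together.
data Tile : Set where
  blank horizontal vertical cross elbowA elbowB doubleElbow : Tile

west : RowType → Tile → Bool
west _ blank       = false
west _ horizontal  = true
west _ vertical    = false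
west _ cross       = true
west 𝗐 elbowA      = true
west 𝖾 elbowA      = false
west 𝗐 elbowB      = false
west 𝖾 elbowB      = true
west _ doubleElbow = true

east : RowType → Tile → Bool
east _ blank       = false
east _ horizontal  = true
east _ vertical    = false
east _ cross       = true
east 𝗐 elbowA      = false
east 𝖾 elbowA      = true
east 𝗐 elbowB      = true
east 𝖾 elbowB      = false
east _ doubleElbow = true

north : RowType → Tile → Bool
north _ blank       = false
north _ horizontal  = false
north _ vertical    = true
north _ cross       = true
north _ elbowA      = true
north _ elbowB      = false
north _ doubleElbow = true

south : RowType → Tile → Bool
south _ blank       = false
south _ horizontal  = false
south _ vertical    = true
south _ cross       = true
south _ elbowA      = false
south _ elbowB      = true
south _ doubleElbow = true

-- Matches t b ts b' : pipes match across every shared vertical edge of the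
-- row ts, where b says whether a pipe crosses the West end and b' whether a
-- pipe crosses the East end.
Matches : RowType → Bool → {n : ℕ} → Vec Tile n → Bool → Set
Matches t b []       b' = b ≡ b'
Matches t b (x ∷ xs) b' = (west t x ≡ b) × Matches t (east t x) xs b'

westEnd : RowType → Bool
westEnd 𝗐 = true
westEnd 𝖾 = false

eastEnd : RowType → Bool
eastEnd 𝗐 = false
eastEnd 𝖾 = true

NoSouth : RowType → {n : ℕ} → Vec Tile n → Set
NoSouth t []       = ⊤
NoSouth t (x ∷ xs) = (south t x ≡ false) × NoSouth t xs

numNorth : RowType → {n : ℕ} → Vec Tile n → ℕ
numNorth t []       = zero
numNorth t (x ∷ xs) with north t x
... | true  = suc (numNorth t xs)
... | false = numNorth t xs

-- A legal row of type t with a single pipe and no pipe crossing the South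
-- boundary.  (Every pipe leaves through the North boundary, so "single pipe"
-- is: exactly one North exit.)
GoodRow : RowType → {n : ℕ} → Vec Tile n → Set
GoodRow t ts = Matches t (westEnd t) ts (eastEnd t) × NoSouth t ts × (numNorth t ts ≡ 1)

Rows : RowType → ℕ → Set
Rows t n = Σ (Vec Tile n) (GoodRow t)

module Weights (R : CommutativeRing 0ℓ 0ℓ) where
  open CommutativeRing R

  wt : RowType → Tile → Carrier → Carrier → Carrier → Carrier → Carrier
  wt _ elbowA      x yj A B = A + B
  wt _ elbowB      x yj A B = A + B
  wt _ doubleElbow x yj A B = A + B
  wt 𝗐 blank       x yj A B = B - x + yj
  wt 𝗐 horizontal  x yj A B = A + x - yj
  wt 𝗐 vertical    x yj A B = A + x - yj
  wt 𝗐 cross       x yj A B = A + x - yj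
  wt 𝖾 blank       x yj A B = A + x - yj
  wt 𝖾 horizontal  x yj A B = B - x + yj
  wt 𝖾 vertical    x yj A B = B - x + yj
  wt 𝖾 cross       x yj A B = B - x + yj

  rowWt : RowType → {n : ℕ} → Vec Tile n → Carrier → Vec Carrier n → Carrier → Carrier → Carrier
  rowWt t []       x []       A B = 1#
  rowWt t (c ∷ cs) x (y ∷ ys) A B = wt t c x y A B * rowWt t cs x ys A B

-- A row with no pipe on its South boundary only uses blank, horizontal and
-- single North elbow tiles.  Exchanging blank and horizontal tiles complements
-- the occupancy of every vertical edge, so it turns the boundary conditions of
-- one row type into those of the other, and it matches the blank weight of one
-- type with the straight weight of the other.  Being an involution, it is a
-- weight-preserving bijection.
module Submission where

open import Defs
open import Level using (0ℓ)
open import Data.Nat using (ℕ; suc)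
open import Data.Nat.Properties using () renaming (≡-irrelevant to ℕ-≡-irrelevant)
open import Data.Bool using (Bool; true; false; not)
open import Data.Bool.Properties using () renaming (_≟_ to _≟ᵇ_)
open import Data.Unit using (tt)
open import Data.Vec using (Vec; []; _∷_; map)
open import Data.Vec.Properties using (map-∘; map-cong; map-id)
open import Data.Product using (Σ; proj₁; _,_; _×_)
open import Function using (_∘_; id)
open import Function.Bundles using (_⤖_; Bijection; mk↔ₛ′)
open import Function.Properties.Inverse using (↔⇒⤖)
open import Algebra.Bundles using (CommutativeRing)
open import Relation.Nullary using (Irrelevant)
open import Relation.Binary.PropositionalEquality
open import Axiom.UniquenessOfIdentityProofs using (module Decidable⇒UIP)

opposite : RowType → RowType
opposite 𝗐 = 𝖾
opposite 𝖾 = 𝗐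

swap : Tile → Tile
swap blank      = horizontal
swap horizontal = blank
swap tile       = tile

swap-involutive : ∀ tile → swap (swap tile) ≡ tile
swap-involutive blank       = refl
swap-involutive horizontal  = refl
swap-involutive vertical    = refl
swap-involutive cross       = refl
swap-involutive elbowA      = refl
swap-involutive elbowB      = refl
swap-involutive doubleElbow = refl

map-swap-involutive : ∀ {n} (ts : Vec Tile n) → map swap (map swap ts) ≡ ts
map-swap-involutive ts = begin
  map swap (map swap ts)  ≡⟨ map-∘ swap swap ts ⟨
  map (swap ∘ swap) ts    ≡⟨ map-cong swap-involutive ts ⟩
  map id ts               ≡⟨ map-id ts ⟩
  ts                      ∎
  where open ≡-Reasoning

westEast-swap : ∀ t tile → south t tile ≡ false →
  west (opposite t) (swap tile) ≡ not (west t tile) × east (opposite t) (swap tile) ≡ not (east t tile)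
westEast-swap t blank      _ = refl , refl
westEast-swap t horizontal _ = refl , refl
westEast-swap 𝗐 elbowA     _ = refl , refl
westEast-swap 𝖾 elbowA     _ = refl , refl
westEast-swap t vertical    ()
westEast-swap t cross       ()
westEast-swap t elbowB      ()
westEast-swap t doubleElbow ()

south-swap : ∀ t u tile → south u (swap tile) ≡ south t tile
south-swap t u blank       = refl
south-swap t u horizontal  = refl
south-swap t u vertical    = refl
south-swap t u cross       = refl
south-swap t u elbowA      = refl
south-swap t u elbowB      = refl
south-swap t u doubleElbow = refl

north-swap : ∀ t u tile → north u (swap tile) ≡ north t tile
north-swap t u blank       = refl
north-swap t u horizontal  = refl
north-swap t u vertical    = refl
north-swap t u cross       = refl
north-swap t u elbowA      = refl
north-swap t u elbowB      = refl
north-swap t u doubleElbow = refl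

Matches-swap : ∀ t b {n} (ts : Vec Tile n) b' → Matches t b ts b' → NoSouth t ts →
  Matches (opposite t) (not b) (map swap ts) (not b')
Matches-swap t b []          b' b≡b'         _               = cong not b≡b'
Matches-swap t b (tile ∷ ts) b' (w≡b , rest) (s≡f , noSouth)
  with westEast-swap t tile s≡f
... | w-swap , e-swap =
  trans w-swap (cong not w≡b) ,
  subst (λ c → Matches (opposite t) c (map swap ts) (not b')) (sym e-swap)
        (Matches-swap t (east t tile) ts b' rest noSouth)

Matches-ends-swap : ∀ t {n} (ts : Vec Tile n) →
  Matches t (westEnd t) ts (eastEnd t) → NoSouth t ts →
  Matches (opposite t) (westEnd (opposite t)) (map swap ts) (eastEnd (opposite t))
Matches-ends-swap 𝗐 ts = Matches-swap 𝗐 true  ts false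
Matches-ends-swap 𝖾 ts = Matches-swap 𝖾 false ts true

NoSouth-swap : ∀ t u {n} (ts : Vec Tile n) → NoSouth t ts → NoSouth u (map swap ts)
NoSouth-swap t u []          _               = tt
NoSouth-swap t u (tile ∷ ts) (s≡f , noSouth) =
  trans (south-swap t u tile) s≡f , NoSouth-swap t u ts noSouth

numNorth-swap : ∀ t u {n} (ts : Vec Tile n) → numNorth u (map swap ts) ≡ numNorth t ts
numNorth-swap t u []          = refl
numNorth-swap t u (tile ∷ ts)
  with north u (swap tile) | north t tile | north-swap t u tile
... | true  | true  | refl = cong suc (numNorth-swap t u ts)
... | false | false | refl = numNorth-swap t u ts

swapRow : ∀ t {n} → Rows t n → Rows (opposite t) n
swapRow t (ts , matches , noSouth , oneNorth) =
  map swap ts ,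
  Matches-ends-swap t ts matches noSouth ,
  NoSouth-swap t (opposite t) ts noSouth ,
  trans (numNorth-swap t (opposite t) ts) oneNorth

Bool-≡-irrelevant : {a b : Bool} → Irrelevant (a ≡ b)
Bool-≡-irrelevant = Decidable⇒UIP.≡-irrelevant _≟ᵇ_

Matches-irrelevant : ∀ t b {n} (ts : Vec Tile n) b' → Irrelevant (Matches t b ts b')
Matches-irrelevant t b []          b' p q = Bool-≡-irrelevant p q
Matches-irrelevant t b (tile ∷ ts) b' (p , p′) (q , q′) =
  cong₂ _,_ (Bool-≡-irrelevant p q) (Matches-irrelevant t (east t tile) ts b' p′ q′)

NoSouth-irrelevant : ∀ t {n} (ts : Vec Tile n) → Irrelevant (NoSouth t ts)
NoSouth-irrelevant t []          _        _        = refl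
NoSouth-irrelevant t (tile ∷ ts) (p , p′) (q , q′) =
  cong₂ _,_ (Bool-≡-irrelevant p q) (NoSouth-irrelevant t ts p′ q′)

GoodRow-irrelevant : ∀ t {n} (ts : Vec Tile n) → Irrelevant (GoodRow t ts)
GoodRow-irrelevant t ts (m , s , k) (m′ , s′ , k′) =
  cong₂ _,_ (Matches-irrelevant t (westEnd t) ts (eastEnd t) m m′)
            (cong₂ _,_ (NoSouth-irrelevant t ts s s′) (ℕ-≡-irrelevant k k′))

Rows-≡ : ∀ {t n} {r s : Rows t n} → proj₁ r ≡ proj₁ s → r ≡ s
Rows-≡ {t} {r = ts , p} {s = .ts , q} refl = cong (ts ,_) (GoodRow-irrelevant t ts p q)

swapBijection : ∀ n → Rows 𝖾 n ⤖ Rows 𝗐 n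
swapBijection n = ↔⇒⤖ (mk↔ₛ′ (swapRow 𝖾) (swapRow 𝗐)
  (λ r → Rows-≡ (map-swap-involutive (proj₁ r)))
  (λ r → Rows-≡ (map-swap-involutive (proj₁ r))))

module _ (R : CommutativeRing 0ℓ 0ℓ) where
  open CommutativeRing R using (Carrier; _*_)
  open Weights R

  wt-swap : ∀ t tile x y A B → south t tile ≡ false →
    wt t tile x y A B ≡ wt (opposite t) (swap tile) x y A B
  wt-swap 𝗐 blank      x y A B _ = refl
  wt-swap 𝖾 blank      x y A B _ = refl
  wt-swap 𝗐 horizontal x y A B _ = refl
  wt-swap 𝖾 horizontal x y A B _ = refl
  wt-swap t elbowA     x y A B _ = refl
  wt-swap t vertical    x y A B ()
  wt-swap t cross       x y A B ()
  wt-swap t elbowB      x y A B ()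
  wt-swap t doubleElbow x y A B ()

  rowWt-swap : ∀ t {n} (ts : Vec Tile n) x (ys : Vec Carrier n) A B → NoSouth t ts →
    rowWt t ts x ys A B ≡ rowWt (opposite t) (map swap ts) x ys A B
  rowWt-swap t []          x []       A B _ = refl
  rowWt-swap t (tile ∷ ts) x (y ∷ ys) A B (s≡f , noSouth) =
    cong₂ _*_ (wt-swap t tile x y A B s≡f) (rowWt-swap t ts x ys A B noSouth)

lemma3p3 : (n : ℕ) → Σ (Rows 𝖾 n ⤖ Rows 𝗐 n) λ φ →
    (R : CommutativeRing 0ℓ 0ℓ) → (x : CommutativeRing.Carrier R) → (y : Vec (CommutativeRing.Carrier R) n) →
    (A B : CommutativeRing.Carrier R) → (r : Rows 𝖾 n) →
    CommutativeRing._≈_ R (Weights.rowWt R 𝖾 (proj₁ r) x y A B) (Weights.rowWt R 𝗐 (proj₁ (Bijection.to φ r)) x y A B)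
lemma3p3 n = swapBijection n ,
  λ { R x y A B (ts , _ , noSouth , _) → CommutativeRing.reflexive R (rowWt-swap R 𝖾 ts x y A B noSouth) }
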